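{- $g_A(n)=\frac{n^2}{4}+O(n)$.
   Context: A tree $T$ is hidden on a known vertex set $V$ with $|V|=n$. A distance query is an unordered pair $\{x,y\}$ of distinct vertices, answered by the distance $d_T(x,y)$ in $T$. In an adaptive algorithm each query may depend on previous answers. A tree on $V$ is consistent with the answers if its distances agree with all answers received. $g_A(n)$ is the smallest $k$ such that there is an adaptive algorithm which, for every hidden tree $T$ on $V$, after at most $k$ queries reaches a state in which $T$ is the only tree on $V$ consistent with the answers. -}

module Defs where

open import Data.Nat using (ℕ; zero; suc; _<_; _≤_)
open import Data.Fin using (Fin)
open import Data.Bool using (Bool; true)
open import Data.List using (List; []; _∷_; _++_; length)
open import Data.List.Relation.Unary.Unique.Propositional using (Unique)
open import Data.Product using (Σ; _×_; ∃; ∃-syntax; Σ-syntax)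
open import Data.Sum using (_⊎_)
open import Data.Unit using (⊤)
open import Relation.Nullary using (¬_)
open import Relation.Binary.PropositionalEquality using (_≡_; _≢_)

Graph : ℕ → Set
Graph n = Fin n → Fin n → Bool

Adj : ∀ {n} → Graph n → Fin n → Fin n → Set
Adj G x y = G x y ≡ true

SameGraph : ∀ {n} → Graph n → Graph n → Set
SameGraph G H = ∀ x y → G x y ≡ H x y

data Walk {n : ℕ} (G : Graph n) : Fin n → Fin n → ℕ → Set where
  stay : ∀ {x} → Walk G x x zero
  step : ∀ {x y z k} → Adj G x y → Walk G y z k → Walk G x z (suc k)

Chain : ∀ {n} → Graph n → List (Fin n) → Set
Chain G [] = ⊤
Chain G (x ∷ []) = ⊤
Chain G (x ∷ y ∷ r) = Adj G x y × Chain G (y ∷ r)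

HasCycle : ∀ {n} → Graph n → Set
HasCycle {n} G = ∃[ x ] ∃[ rest ]
  (2 ≤ length rest × Unique (x ∷ rest) × Chain G (x ∷ rest ++ x ∷ []))

Connected : ∀ {n} → Graph n → Set
Connected G = ∀ x y → ∃[ k ] Walk G x y k

IsTree : ∀ {n} → Graph n → Set
IsTree G = (∀ x y → G x y ≡ G y x) × (∀ x → ¬ Adj G x x)
         × Connected G × ¬ HasCycle G

Dist : ∀ {n} → Graph n → Fin n → Fin n → ℕ → Set
Dist G x y k = Walk G x y k × (∀ m → m < k → ¬ Walk G x y m)

-- Adaptive algorithm = decision tree: either stop, or query a pair {x,y}
-- of distinct vertices and continue depending on the answer.
data Alg (n : ℕ) : Set where
  done : Alg n
  ask  : (x y : Fin n) → x ≢ y → (ℕ → Alg n) → Alg n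

-- Knowledge state: a predicate on candidate graphs (conjunction of answers so far).
-- T is the only tree on V consistent with the knowledge C.
Determined : ∀ {n} → Graph n → (Graph n → Set) → Set
Determined T C = ∀ T' → IsTree T' → C T' → SameGraph T' T

Reaches : ∀ {n} → Graph n → (Graph n → Set) → Alg n → ℕ → Set
Reaches T C done k = Determined T C
Reaches T C (ask x y _ f) zero = Determined T C
Reaches T C (ask x y _ f) (suc k) =
  Determined T C ⊎
  (∀ a → Dist T x y a → Reaches T (λ T' → C T' × Dist T' x y a) (f a) k)

-- Solvable n k  ⇔  g_A(n) ≤ k.
Solvable : ℕ → ℕ → Set
Solvable n k = Σ[ A ∈ Alg n ] (∀ (T : Graph n) → IsTree T → Reaches T (λ _ → ⊤) A k)

{-# OPTIONS --safe #-}
module Submission where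

-- Upper bound: ask the distances from a root r to all other vertices, then ask d(x, y) for every pair
-- with d(r, x) = d(r, y) + 1.  The edges of the tree are exactly such pairs at distance 1, and since
-- their depths have opposite parities there are at most n²/4 of them.
-- Lower bound: an adversary hides a tree made of a root, a + 1 middle vertices A p below it and m leaves
-- B q, leaf q hanging from A (f q).  Each answer is either already forced or commits the adversary to one
-- constraint f q ≠ p or f q ≠ f q′.  A Kempe-chain argument shows that f is only determined once there
-- are at least m·a constraints, which is about n²/4 for a ≈ m ≈ n/2.

open import Defs
open import Data.Nat using (ℕ; _≤_; _+_; _*_)
open import Data.Product using (_×_; ∃-syntax)

open import Data.Nat using (zero; suc; _<_; _≤?_; z≤n; s≤s; parity)
open import Data.Nat.Properties
  using ( _≟_; <-cmp; <-trans; <-irrefl; <-asym; ≤-refl; ≤-trans; ≤-reflexive; ≤-total; ≤-<-connex; n≤1+n; 1+n≢n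
        ; n≤0⇒n≡0; m≤m+n; m≤n+m; m+n≤o⇒m≤o; m≤n⇒∃[o]m+o≡n; +-suc; +-identityʳ; +-comm; *-comm; *-suc
        ; *-distribˡ-+; +-mono-≤; +-monoˡ-≤; +-monoʳ-≤; *-monoˡ-≤; *-monoʳ-≤; module ≤-Reasoning )
open import Data.Nat.DivMod using (_/_; m/n*n≤m; m*n/n≡m; /-monoˡ-≤)
open import Data.Nat.Induction using (<-rec)
open import Data.Nat.ListAction using (sum)
open import Data.Nat.Tactic.RingSolver using (solve-∀)
open import Data.Parity.Base as ℙ using (Parity; 0ℙ; 1ℙ; _⁻¹)
open import Data.Parity.Properties using (p+p≡0ℙ; +-homo-+; ⁻¹-selfInverse) renaming (_≟_ to _≟ᵖ_; +-assoc to ℙ+-assoc)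
open import Data.Fin using (Fin; zero; suc; punchIn; _↑ˡ_; _↑ʳ_; splitAt; join; remQuot; combine) renaming (_≟_ to _≟ᶠ_)
open import Data.Fin.Properties
  using (punchInᵢ≢i; punchIn-injective; injective⇒≤; combine-remQuot; splitAt-join; splitAt-↑ˡ; splitAt-↑ʳ; join-splitAt)
open import Data.Bool using (Bool; true; false; if_then_else_)
open import Data.Bool.Properties using (⇔→≡)
open import Data.List using (List; []; _∷_; _++_; length; map; lookup; allFin)
open import Data.List.Properties using (length-tabulate)
open import Data.List.Membership.Propositional using (_∈_; _∉_)
open import Data.List.Membership.Propositional.Properties using (∈-allFin; ∈-map⁺)
open import Data.List.Relation.Unary.All using (All; []; _∷_)
import Data.List.Relation.Unary.All as All
open import Data.List.Relation.Unary.All.Properties using (¬Any⇒All¬)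
open import Data.List.Relation.Unary.AllPairs using ([]; _∷_)
import Data.List.Relation.Unary.AllPairs.Properties as AllPairs
open import Data.List.Relation.Unary.Any using (here; there; index)
open import Data.List.Relation.Unary.Any.Properties using (lookup-index)
open import Data.List.Relation.Unary.Unique.Propositional using (Unique)
open import Data.Vec.Functional using (updateAt)
open import Data.Vec.Functional.Properties using (updateAt-updates; updateAt-minimal)
open import Data.Product using (Σ; _,_; proj₁; proj₂; ∃; uncurry)
open import Data.Product.Properties using (≡-dec; ,-injective; ×-≡,≡→≡)
open import Data.Sum using (_⊎_; inj₁; inj₂; [_,_]′; swap)
open import Data.Empty using (⊥; ⊥-elim)
open import Data.Unit using (⊤; tt)
open import Effect.Monad using (RawMonad)
open import Function using (_∘_; const; id)
open import Function.Bundles using (mk⇔)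
open import Level using (0ℓ)
open import Relation.Binary using (Rel; tri<; tri≈; tri>)
open import Relation.Binary.Construct.Closure.ReflexiveTransitive using (Star; ε; _◅_; _◅◅_; reverse)
open import Relation.Binary.PropositionalEquality
  using (_≡_; _≢_; ≢-sym; refl; sym; trans; cong; cong₂; subst; subst₂; module ≡-Reasoning)
open import Relation.Nullary using (¬_; Dec; yes; no; does)
open import Relation.Nullary.Decidable using (dec-true; dec-false; decidable-stable)
open import Relation.Nullary.Decidable.Core using (¬¬-excluded-middle)
open import Relation.Nullary.Negation using (¬¬-Monad; DoubleNegation)
open import Relation.Unary using (Pred; _⊆_)

open RawMonad (¬¬-Monad {0ℓ}) using (_>>=_; pure)

variable
  k l : ℕ

-- Walks and distances

module _ {n : ℕ} {G : Graph n} where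

  walk-++ : ∀ {x y z} → Walk G x y k → Walk G y z l → Walk G x z (k + l)
  walk-++ stay w = w
  walk-++ (step e v) w = step e (walk-++ v w)

  walk-∷ʳ : ∀ {x y z} → Walk G x y k → Adj G y z → Walk G x z (suc k)
  walk-∷ʳ {k = k} w e = subst (Walk G _ _) (+-comm k 1) (walk-++ w (step e stay))

  walk-reverse : (∀ x y → G x y ≡ G y x) → ∀ {x y} → Walk G x y k → Walk G y x k
  walk-reverse symmetric stay = stay
  walk-reverse symmetric (step {x} {y} e w) = walk-∷ʳ (walk-reverse symmetric w) (trans (symmetric y x) e)

  walk₀⇒≡ : ∀ {x y} → Walk G x y 0 → x ≡ y
  walk₀⇒≡ stay = refl

  walk₁⇒adj : ∀ {x y} → Walk G x y 1 → Adj G x y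
  walk₁⇒adj (step e stay) = e

  walk₂⇒common-neighbour : ∀ {x y} → Walk G x y 2 → ∃[ w ] (Adj G x w × Adj G w y)
  walk₂⇒common-neighbour (step e (step e′ stay)) = _ , e , e′

  walk-parity : (colour : Fin n → Parity) → (∀ x y → Adj G x y → colour x ≡ colour y ⁻¹) →
                ∀ {x y} → Walk G x y k → parity k ≡ colour x ℙ.+ colour y
  walk-parity colour proper {x} stay = sym (p+p≡0ℙ (colour x))
  walk-parity {k = suc k} colour proper {x} {z} (step {y = y} e w) = begin
    parity (suc k)                   ≡⟨ +-homo-+ 1 k ⟩
    1ℙ ℙ.+ parity k                  ≡⟨ cong (1ℙ ℙ.+_) (walk-parity colour proper w) ⟩
    1ℙ ℙ.+ (colour y ℙ.+ colour z)   ≡⟨ sym (ℙ+-assoc 1ℙ (colour y) (colour z)) ⟩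
    colour y ⁻¹ ℙ.+ colour z         ≡⟨ cong (ℙ._+ colour z) (sym (proper x y e)) ⟩
    colour x ℙ.+ colour z            ∎
    where open ≡-Reasoning

  dist-functional : ∀ {x y a b} → Dist G x y a → Dist G x y b → a ≡ b
  dist-functional {a = a} {b} (wa , min-a) (wb , min-b) with <-cmp a b
  ... | tri< a<b _ _ = ⊥-elim (min-b a a<b wa)
  ... | tri≈ _ a≡b _ = a≡b
  ... | tri> _ _ b<a = ⊥-elim (min-a b b<a wb)

  adj⇒dist₁ : ∀ {x y} → x ≢ y → Adj G x y → Dist G x y 1
  adj⇒dist₁ x≢y e = step e stay , λ { zero _ w → x≢y (walk₀⇒≡ w) ; (suc _) (s≤s ()) _ }

-- Trees

module _ {n : ℕ} {R : Rel (Fin n) 0ℓ} where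
  open import Data.List.Membership.DecPropositional (_≟ᶠ_ {n}) using (_∈?_)

  visited : ∀ {x y} → Star R x y → List (Fin n)
  visited ε = []
  visited (_◅_ {j = y} _ w) = y ∷ visited w

  SimplePath : Fin n → Fin n → Set
  SimplePath x y = Σ (Star R x y) λ w → Unique (x ∷ visited w)

  simplePath-from : ∀ {y z} (w : Star R y z) → Unique (y ∷ visited w) → ∀ {x} → x ∈ visited w → SimplePath x z
  simplePath-from (_ ◅ w) (_ ∷ u) (here refl) = w , u
  simplePath-from (_ ◅ w) (_ ∷ u) (there x∈w) = simplePath-from w u x∈w

  toSimplePath : ∀ {x y} → Star R x y → SimplePath x y
  toSimplePath ε = ε , [] ∷ []
  toSimplePath {x} (_◅_ {j = y} r w) with toSimplePath w
  ... | w′ , u with x ∈? (y ∷ visited w′)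
  ... | yes (here refl) = w′ , u
  ... | yes (there x∈w′) = simplePath-from w′ u x∈w′
  ... | no x∉w′ = r ◅ w′ , ¬Any⇒All¬ _ x∉w′ ∷ u

  module _ {G : Graph n} (R⇒Adj : ∀ {x y} → R x y → Adj G x y) where

    path-chain : ∀ {x y z} (w : Star R x y) → Adj G y z → Chain G (x ∷ visited w ++ z ∷ [])
    path-chain ε e = e , tt
    path-chain (r ◅ w) e = R⇒Adj r , path-chain w e

    -- A path from x to y other than the edge xy would close a cycle with it.
    tree-edge-on-path : IsTree G → ∀ {x y} → Adj G x y → Star R x y → R x y
    tree-edge-on-path (symmetric , loopless , _ , acyclic) {x} {y} e w with toSimplePath w
    ... | ε , _ = ⊥-elim (loopless x e)
    ... | r ◅ ε , _ = r
    ... | w′@(_ ◅ _ ◅ _) , u =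
      ⊥-elim (acyclic (x , visited w′ , s≤s (s≤s z≤n) , u , path-chain w′ (trans (symmetric y x) e)))

lastOf : ∀ {A : Set} → A → List A → A
lastOf z [] = z
lastOf z (w ∷ ws) = lastOf w ws

lastOf-∷ʳ : ∀ {A : Set} (z : A) ws e → lastOf z (ws ++ e ∷ []) ≡ e
lastOf-∷ʳ z [] e = refl
lastOf-∷ʳ z (w ∷ ws) e = lastOf-∷ʳ w ws e

lastOf-∈ : ∀ {A : Set} (z : A) ws → lastOf z ws ∈ z ∷ ws
lastOf-∈ z [] = here refl
lastOf-∈ z (w ∷ ws) = there (lastOf-∈ w ws)

module _ {A : Set} where

  NonBacktracking : List A → Set
  NonBacktracking (a ∷ b ∷ c ∷ zs) = a ≢ c × NonBacktracking (b ∷ c ∷ zs)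
  NonBacktracking _ = ⊤

  unique⇒nonBacktracking : ∀ zs → Unique zs → NonBacktracking zs
  unique⇒nonBacktracking (a ∷ b ∷ c ∷ zs) ((_ ∷ a≢c ∷ _) ∷ u) = a≢c , unique⇒nonBacktracking (b ∷ c ∷ zs) u
  unique⇒nonBacktracking [] _ = tt
  unique⇒nonBacktracking (_ ∷ []) _ = tt
  unique⇒nonBacktracking (_ ∷ _ ∷ []) _ = tt

  LastStep : (A → A → Set) → A → A → List A → Set
  LastStep P u v [] = P u v
  LastStep P u v (w ∷ ws) = LastStep P v w ws

  lastStep-∷ʳ : ∀ P u v ws e → LastStep P u v (ws ++ e ∷ []) ≡ P (lastOf v ws) e
  lastStep-∷ʳ P u v [] e = refl
  lastStep-∷ʳ P u v (w ∷ ws) e = lastStep-∷ʳ P v w ws e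

chain⇒lastStep : ∀ {n} {G : Graph n} u v zs → Chain G (u ∷ v ∷ zs) → LastStep (Adj G) u v zs
chain⇒lastStep u v [] (e , _) = e
chain⇒lastStep u v (w ∷ ws) (_ , ch) = chain⇒lastStep v w ws ch

module _ {n : ℕ} (parent : Fin n → Fin n) (height : Fin n → ℕ) where

  ToParent ToChild : Fin n → Fin n → Set
  ToParent u v = v ≡ parent u × height v < height u
  ToChild u v = u ≡ parent v × height u < height v

  lastStep-conflict : ∀ u v zs → LastStep ToParent u v zs → LastStep ToChild u v zs → ⊥
  lastStep-conflict u v [] up down = <-asym (proj₂ up) (proj₂ down)
  lastStep-conflict u v (w ∷ ws) = lastStep-conflict v w ws

  module _ {G : Graph n} (parent-edge : ∀ {u v} → Adj G u v → ToParent u v ⊎ ToChild u v) where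

    descent : ∀ z₀ z₁ zs → Chain G (z₀ ∷ z₁ ∷ zs) → NonBacktracking (z₀ ∷ z₁ ∷ zs) → ToChild z₀ z₁ →
              height z₀ < height (lastOf z₁ zs) × LastStep ToChild z₀ z₁ zs
    descent z₀ z₁ [] _ _ down = proj₂ down , down
    descent z₀ z₁ (z₂ ∷ zs) (_ , e₁₂ , ch) (z₀≢z₂ , nb) down with parent-edge e₁₂
    ... | inj₁ (z₂≡ , _) = ⊥-elim (z₀≢z₂ (trans (proj₁ down) (sym z₂≡)))
    ... | inj₂ down′ with descent z₁ z₂ zs (e₁₂ , ch) nb down′
    ... | lt , last = <-trans (proj₂ down) lt , last

    ascent : ∀ z₀ z₁ zs → Chain G (z₀ ∷ z₁ ∷ zs) → NonBacktracking (z₀ ∷ z₁ ∷ zs) →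
             LastStep ToParent z₀ z₁ zs → height (lastOf z₁ zs) < height z₀
    ascent z₀ z₁ [] _ _ up = proj₂ up
    ascent z₀ z₁ (z₂ ∷ zs) (e₀₁ , ch) (z₀≢z₂ , nb) up with parent-edge e₀₁
    ... | inj₁ up′ = <-trans (ascent z₁ z₂ zs ch nb up) (proj₂ up′)
    ... | inj₂ down =
      ⊥-elim (lastStep-conflict z₁ z₂ zs up (proj₂ (descent z₀ z₁ (z₂ ∷ zs) (e₀₁ , ch) (z₀≢z₂ , nb) down)))

    -- A cycle starting downwards goes down forever; one starting upwards must also end upwards
    -- (its last vertex differs from the parent x₁ of x₀), hence goes up all the way.
    parent-edges⇒acyclic : ¬ HasCycle G
    parent-edges⇒acyclic (x₀ , [] , () , _)
    parent-edges⇒acyclic (x₀ , _ ∷ [] , s≤s () , _)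
    parent-edges⇒acyclic (x₀ , x₁ ∷ x₂ ∷ rest , _ , x₀∉ ∷ unique@(x₁∉ ∷ _) , chain) =
      [ ascending , descending ]′ (parent-edge (proj₁ chain))
      where
      cycle : List (Fin n)
      cycle = x₂ ∷ rest ++ x₀ ∷ []

      nonBacktracking : NonBacktracking (x₀ ∷ x₁ ∷ cycle)
      nonBacktracking = All.lookup x₀∉ (there (here refl)) ,
        unique⇒nonBacktracking (x₁ ∷ cycle)
          (AllPairs.++⁺ unique ([] ∷ []) (All.map (λ x₀≢ → ≢-sym x₀≢ ∷ []) x₀∉))

      descending : ToChild x₀ x₁ → ⊥
      descending down = <-irrefl (sym (cong height (lastOf-∷ʳ x₂ rest x₀)))
        (proj₁ (descent x₀ x₁ cycle chain nonBacktracking down))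

      ascending : ToParent x₀ x₁ → ⊥
      ascending up = <-irrefl (cong height (lastOf-∷ʳ x₂ rest x₀)) (ascent x₀ x₁ cycle chain nonBacktracking lastUp)
        where
        x₁≢penultimate : x₁ ≢ lastOf x₂ rest
        x₁≢penultimate = All.lookup x₁∉ (lastOf-∈ x₂ rest)
        lastEdge : Adj G (lastOf x₂ rest) x₀
        lastEdge = subst id (lastStep-∷ʳ (Adj G) x₁ x₂ rest x₀) (chain⇒lastStep x₀ x₁ cycle chain)
        lastUp : LastStep ToParent x₀ x₁ cycle
        lastUp = subst id (sym (lastStep-∷ʳ ToParent x₁ x₂ rest x₀))
          ([ id , (λ down → ⊥-elim (x₁≢penultimate (trans (proj₁ up) (sym (proj₁ down))))) ]′ (parent-edge lastEdge))

-- Pairs at consecutive depths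

indicator : ∀ {P : Set} → Dec P → ℕ
indicator (yes _) = 1
indicator (no _) = 0

indicator-yes : ∀ {P : Set} (d : Dec P) → P → indicator d ≡ 1
indicator-yes (yes _) _ = refl
indicator-yes (no ¬p) p = ⊥-elim (¬p p)

4*-≤-square : ∀ a b → 4 * (a * b) ≤ (a + b) * (a + b)
4*-≤-square a b = [ ordered , (λ b≤a → subst₂ (λ p s → 4 * p ≤ s * s) (*-comm b a) (+-comm b a) (ordered b≤a)) ]′
  (≤-total a b)
  where
  square-identity : ∀ a t → 4 * (a * (a + t)) + t * t ≡ (a + (a + t)) * (a + (a + t))
  square-identity = solve-∀
  ordered : ∀ {a b} → a ≤ b → 4 * (a * b) ≤ (a + b) * (a + b)
  ordered {a} a≤b with m≤n⇒∃[o]m+o≡n a≤b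
  ... | t , refl = m+n≤o⇒m≤o _ (≤-reflexive (square-identity a t))

module _ {V : Set} where

  sum-map-+ : ∀ (f g : V → ℕ) xs → sum (map (λ v → f v + g v) xs) ≡ sum (map f xs) + sum (map g xs)
  sum-map-+ f g [] = refl
  sum-map-+ f g (x ∷ xs) = trans (cong (f x + g x +_) (sum-map-+ f g xs)) (+-+-comm (f x) (g x) _ _)
    where
    +-+-comm : ∀ a b c d → (a + b) + (c + d) ≡ (a + c) + (b + d)
    +-+-comm = solve-∀

  sum-map-mono : ∀ {f g : V → ℕ} xs → (∀ v → f v ≤ g v) → sum (map f xs) ≤ sum (map g xs)
  sum-map-mono [] f≤g = z≤n
  sum-map-mono (x ∷ xs) f≤g = +-mono-≤ (f≤g x) (sum-map-mono xs f≤g)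

  pairSum : (V → V → ℕ) → List V → ℕ
  pairSum F xs = sum (map (λ x → sum (map (F x) xs)) xs)

  module _ (colour : V → Parity) where

    colourCount : Parity → List V → ℕ
    colourCount p xs = sum (map (λ v → indicator (colour v ≟ᵖ p)) xs)

    colourCount-total : ∀ xs → colourCount 0ℙ xs + colourCount 1ℙ xs ≡ length xs
    colourCount-total [] = refl
    colourCount-total (x ∷ xs) with colour x
    ... | 0ℙ = cong suc (colourCount-total xs)
    ... | 1ℙ = trans (+-suc _ _) (cong suc (colourCount-total xs))

    pairSum-step : ∀ F x xs → pairSum F (x ∷ xs) ≡ F x x + (sum (map (λ y → F x y + F y x) xs) + pairSum F xs)
    pairSum-step F x xs = begin
      (F x x + sum (map (F x) xs)) + sum (map (λ u → F u x + sum (map (F u) xs)) xs)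
        ≡⟨ cong (F x x + sum (map (F x) xs) +_) (sum-map-+ (λ u → F u x) (λ u → sum (map (F u) xs)) xs) ⟩
      (F x x + sum (map (F x) xs)) + (sum (map (λ u → F u x) xs) + pairSum F xs)
        ≡⟨ regroup (F x x) _ _ _ ⟩
      F x x + ((sum (map (F x) xs) + sum (map (λ u → F u x) xs)) + pairSum F xs)
        ≡⟨ cong (λ s → F x x + (s + pairSum F xs)) (sym (sum-map-+ (F x) (λ y → F y x) xs)) ⟩
      F x x + (sum (map (λ y → F x y + F y x) xs) + pairSum F xs) ∎
      where
      open ≡-Reasoning
      regroup : ∀ a b c d → (a + b) + (c + d) ≡ a + ((b + c) + d)
      regroup = solve-∀

    pairSum-bipartite : (F : V → V → ℕ) → (∀ x y → F x y + F y x ≤ indicator (colour y ≟ᵖ colour x ⁻¹)) →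
                        ∀ xs → pairSum F xs ≤ colourCount 0ℙ xs * colourCount 1ℙ xs
    pairSum-bipartite F bound [] = z≤n
    pairSum-bipartite F bound (x ∷ xs) = begin
      pairSum F (x ∷ xs)
        ≡⟨ pairSum-step F x xs ⟩
      F x x + (sum (map (λ y → F x y + F y x) xs) + pairSum F xs)
        ≡⟨ cong (_+ (sum (map (λ y → F x y + F y x) xs) + pairSum F xs)) F-diagonal ⟩
      sum (map (λ y → F x y + F y x) xs) + pairSum F xs
        ≤⟨ +-mono-≤ (sum-map-mono xs (bound x)) (pairSum-bipartite F bound xs) ⟩
      colourCount (colour x ⁻¹) xs + colourCount 0ℙ xs * colourCount 1ℙ xs
        ≡⟨ colourCount-∷ ⟩
      colourCount 0ℙ (x ∷ xs) * colourCount 1ℙ (x ∷ xs) ∎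
      where
      open ≤-Reasoning
      no-monochromatic-pair : ∀ p → indicator (p ≟ᵖ p ⁻¹) ≡ 0
      no-monochromatic-pair 0ℙ = refl
      no-monochromatic-pair 1ℙ = refl
      F-diagonal : F x x ≡ 0
      F-diagonal = n≤0⇒n≡0 (m+n≤o⇒m≤o (F x x) (≤-trans (bound x x) (≤-reflexive (no-monochromatic-pair (colour x)))))
      colourCount-∷ : colourCount (colour x ⁻¹) xs + colourCount 0ℙ xs * colourCount 1ℙ xs
                    ≡ colourCount 0ℙ (x ∷ xs) * colourCount 1ℙ (x ∷ xs)
      colourCount-∷ with colour x
      ... | 0ℙ = refl
      ... | 1ℙ = sym (*-suc (colourCount 0ℙ xs) (colourCount 1ℙ xs))

module _ {V : Set} (depth : V → ℕ) where

  OneDeeper : V → V → Set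
  OneDeeper x y = suc (depth y) ≡ depth x

  oneDeeper? : ∀ x y → Dec (OneDeeper x y)
  oneDeeper? x y = suc (depth y) ≟ depth x

  oneDeeper⇒opposite-parity : ∀ {x y} → OneDeeper x y → parity (depth x) ≡ parity (depth y) ⁻¹
  oneDeeper⇒opposite-parity {y = y} deeper = trans (cong parity (sym deeper)) (+-homo-+ 1 (depth y))

  oneDeeper-pair≤opposite-parity : ∀ x y → indicator (oneDeeper? x y) + indicator (oneDeeper? y x)
                         ≤ indicator (parity (depth y) ≟ᵖ parity (depth x) ⁻¹)
  oneDeeper-pair≤opposite-parity x y with oneDeeper? x y | oneDeeper? y x
  ... | yes x-deeper | yes y-deeper = ⊥-elim (<-asym (≤-reflexive x-deeper) (≤-reflexive y-deeper))
  ... | yes x-deeper | no _ = ≤-reflexive (sym (indicator-yes (parity (depth y) ≟ᵖ parity (depth x) ⁻¹)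
                                (sym (⁻¹-selfInverse (sym (oneDeeper⇒opposite-parity x-deeper))))))
  ... | no _ | yes y-deeper = ≤-reflexive (sym (indicator-yes (parity (depth y) ≟ᵖ parity (depth x) ⁻¹)
                                (oneDeeper⇒opposite-parity y-deeper)))
  ... | no _ | no _ = z≤n

  4*oneDeeperPairs≤square : ∀ xs → 4 * pairSum (λ x y → indicator (oneDeeper? x y)) xs ≤ length xs * length xs
  4*oneDeeperPairs≤square xs = begin
    4 * pairSum (λ x y → indicator (oneDeeper? x y)) xs
      ≤⟨ *-monoʳ-≤ 4 (pairSum-bipartite (parity ∘ depth) _ oneDeeper-pair≤opposite-parity xs) ⟩
    4 * (evens * odds)  ≤⟨ 4*-≤-square evens odds ⟩
    (evens + odds) * (evens + odds)
      ≡⟨ cong (λ s → s * s) (colourCount-total (parity ∘ depth) xs) ⟩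
    length xs * length xs ∎
    where
    open ≤-Reasoning
    evens odds : ℕ
    evens = colourCount (parity ∘ depth) 0ℙ xs
    odds = colourCount (parity ∘ depth) 1ℙ xs

-- The upper bound

module _ {V : Set} {depth : V → ℕ} where
  oneDeeper⇒≢ : ∀ {x y} → OneDeeper depth x y → x ≢ y
  oneDeeper⇒≢ deeper refl = 1+n≢n deeper

Knowledge : ℕ → Set₁
Knowledge n = Pred (Graph n) 0ℓ

reaches-weaken : ∀ {n} {T : Graph n} (alg : Alg n) {C : Knowledge n} {k k′} → k ≤ k′ →
                 Reaches T C alg k → Reaches T C alg k′
reaches-weaken done _ r = r
reaches-weaken (ask x y _ f) {k = zero} {zero} _ r = r
reaches-weaken (ask x y _ f) {k = zero} {suc k′} _ r = inj₁ r
reaches-weaken (ask x y _ f) {k = suc k} {suc k′} _ (inj₁ r) = inj₁ r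
reaches-weaken (ask x y _ f) {k = suc k} {suc k′} (s≤s k≤k′) (inj₂ r) = inj₂ (λ a d → reaches-weaken (f a) k≤k′ (r a d))

module Levels (n : ℕ) where

  V : Set
  V = Fin (suc n)

  root : V
  root = zero

  askParents : (depth : V → ℕ) → V → List V → Alg (suc n) → Alg (suc n)
  askParents depth x [] next = next
  askParents depth x (y ∷ ys) next with oneDeeper? depth x y
  ... | yes deeper = ask x y (oneDeeper⇒≢ deeper) (λ _ → askParents depth x ys next)
  ... | no _ = askParents depth x ys next

  askAllParents : (depth : V → ℕ) → List V → Alg (suc n)
  askAllParents depth [] = done
  askAllParents depth (x ∷ xs) = askParents depth x (allFin _) (askAllParents depth xs)

  exploreDepths : List (Fin n) → (V → ℕ) → Alg (suc n)
  exploreDepths [] depth = askAllParents depth (allFin _)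
  exploreDepths (i ∷ is) depth = ask root (suc i) (λ ()) (λ a → exploreDepths is (updateAt depth (suc i) (const a)))

  levelAlgorithm : Alg (suc n)
  levelAlgorithm = exploreDepths (allFin n) (const 0)

  parentCount : (depth : V → ℕ) → V → List V → ℕ
  parentCount depth x ys = sum (map (indicator ∘ oneDeeper? depth x) ys)

  pairCount-bound : ∀ depth → sum (map (λ x → parentCount depth x (allFin _)) (allFin _)) ≤ (suc n * suc n) / 4
  pairCount-bound depth = begin
    pairs               ≡⟨ sym (m*n/n≡m pairs 4) ⟩
    (pairs * 4) / 4     ≤⟨ /-monoˡ-≤ 4 (begin
      pairs * 4                                      ≡⟨ *-comm pairs 4 ⟩
      4 * pairs                                      ≤⟨ 4*oneDeeperPairs≤square depth (allFin _) ⟩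
      length (allFin (suc n)) * length (allFin (suc n)) ≡⟨ cong (λ l → l * l) (length-tabulate {n = suc n} id) ⟩
      suc n * suc n                                  ∎) ⟩
    (suc n * suc n) / 4 ∎
    where
    open ≤-Reasoning
    pairs : ℕ
    pairs = sum (map (λ x → parentCount depth x (allFin _)) (allFin _))

  module Run (T : Graph (suc n)) (tree : IsTree T) where

    Adj-sym : ∀ {x y} → Adj T x y → Adj T y x
    Adj-sym {x} {y} e = trans (proj₁ tree y x) e

    Knows : Knowledge (suc n) → V → V → Set
    Knows C x y = ∀ {T′} → C T′ → ∀ a → Dist T x y a → Dist T′ x y a

    module _ (depth : V → ℕ) where

      askParents-reaches : ∀ x ys next b C →
        (∀ C′ → C′ ⊆ C → (∀ y → y ∈ ys → OneDeeper depth x y → Knows C′ x y) → Reaches T C′ next b) →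
        Reaches T C (askParents depth x ys next) (parentCount depth x ys + b)
      askParents-reaches x [] next b C cont = cont C (λ c → c) (λ _ ())
      askParents-reaches x (y ∷ ys) next b C cont with oneDeeper? depth x y
      ... | yes _ = inj₂ λ a d → askParents-reaches x ys next b _ λ C′ C′⊆ knows →
            cont C′ (proj₁ ∘ C′⊆)
              λ { _ (here refl) _ c a′ d′ → subst (Dist _ x y) (dist-functional d d′) (proj₂ (C′⊆ c))
                ; y′ (there y′∈) deeper → knows y′ y′∈ deeper }
      ... | no shallow = askParents-reaches x ys next b C λ C′ C′⊆ knows → cont C′ C′⊆
              λ { _ (here refl) deeper → ⊥-elim (shallow deeper) ; y′ (there y′∈) → knows y′ y′∈ }

      askAllParents-reaches : ∀ xs C →
        (∀ C′ → C′ ⊆ C → (∀ x → x ∈ xs → ∀ y → OneDeeper depth x y → Knows C′ x y) → Determined T C′) →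
        Reaches T C (askAllParents depth xs) (sum (map (λ x → parentCount depth x (allFin _)) xs))
      askAllParents-reaches [] C cont = cont C (λ c → c) (λ _ ())
      askAllParents-reaches (x ∷ xs) C cont = askParents-reaches x (allFin _) (askAllParents depth xs) _ C
        λ C′ C′⊆ knows-x → askAllParents-reaches xs C′ λ C″ C″⊆ knows-xs → cont C″ (C′⊆ ∘ C″⊆)
          λ { _ (here refl) y deeper c → knows-x y (∈-allFin y) deeper (C″⊆ c)
            ; x′ (there x′∈) → knows-xs x′ x′∈ }

    IsDepth : (V → ℕ) → Set
    IsDepth depth = ∀ x → Dist T root x (depth x)

    module _ {depth : V → ℕ} (isDepth : IsDepth depth) where

      depth-parent : ∀ x {d} → depth x ≡ suc d → ∃[ y ] (Adj T x y × depth y ≡ d)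
      depth-parent x {d} eq with walk-reverse (proj₁ tree) (subst (Walk T root x) eq (proj₁ (isDepth x)))
      ... | step {y = y} e w = y , e , dist-functional (isDepth y) (walk-reverse (proj₁ tree) w , no-shortcut)
        where
        no-shortcut : ∀ m → m < d → ¬ Walk T root y m
        no-shortcut m m<d w′ = proj₂ (isDepth x) (suc m) (subst (suc m <_) (sym eq) (s≤s m<d)) (walk-∷ʳ w′ (Adj-sym e))

      LevelEdge : V → V → Set
      LevelEdge x y = Adj T x y × OneDeeper depth x y

      TreeStep : V → V → Set
      TreeStep x y = LevelEdge x y ⊎ LevelEdge y x

      path-to-root : ∀ d x → depth x ≡ d → Star TreeStep x root
      path-to-root zero x eq = subst (λ z → Star TreeStep z root) (walk₀⇒≡ (subst (Walk T root x) eq (proj₁ (isDepth x)))) ε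
      path-to-root (suc d) x eq with depth-parent x eq
      ... | y , e , eq′ = inj₁ (e , trans (cong suc eq′) (sym eq)) ◅ path-to-root d y eq′

      -- Every edge of a tree T′ lies on the path of level edges joining its ends, and T′ contains
      -- all level edges of T; the same holds with T and T′ exchanged.
      determined-by-levels : ∀ C → (∀ x y → OneDeeper depth x y → Knows C x y) → Determined T C
      determined-by-levels C knows T′ tree′ c x y = ⇔→≡ (mk⇔
        (λ e → step⇒T (tree-edge-on-path step⇒T′ tree′ e path))
        (λ e → step⇒T′ (tree-edge-on-path step⇒T tree e path)))
        where
        step⇒T : ∀ {u v} → TreeStep u v → Adj T u v
        step⇒T (inj₁ (e , _)) = e
        step⇒T (inj₂ (e , _)) = Adj-sym e
        level⇒T′ : ∀ {u v} → LevelEdge u v → Adj T′ u v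
        level⇒T′ {u} {v} (e , deeper) = walk₁⇒adj (proj₁ (knows u v deeper c 1 (adj⇒dist₁ (oneDeeper⇒≢ deeper) e)))
        step⇒T′ : ∀ {u v} → TreeStep u v → Adj T′ u v
        step⇒T′ (inj₁ l) = level⇒T′ l
        step⇒T′ (inj₂ l) = trans (proj₁ tree′ _ _) (level⇒T′ l)
        path : Star TreeStep x y
        path = path-to-root _ x refl ◅◅ reverse swap (path-to-root _ y refl)

    exploreDepths-reaches : ∀ is depth C → (∀ x → x ∉ map suc is → Dist T root x (depth x)) →
                            Reaches T C (exploreDepths is depth) (length is + (suc n * suc n) / 4)
    exploreDepths-reaches [] depth C isDepth = reaches-weaken (askAllParents depth (allFin _)) (pairCount-bound depth)
      (askAllParents-reaches depth (allFin _) C λ C′ _ knows →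
        determined-by-levels (λ x → isDepth x λ ()) C′ (λ x → knows x (∈-allFin x)))
    exploreDepths-reaches (i ∷ is) depth C isDepth = inj₂ λ a d → exploreDepths-reaches is _ _ (updated a d)
      where
      updated : ∀ a → Dist T root (suc i) a → ∀ x → x ∉ map suc is → Dist T root x (updateAt depth (suc i) (const a) x)
      updated a d x x∉ with x ≟ᶠ suc i
      ... | yes refl = subst (Dist T root x) (sym (updateAt-updates (suc i) depth)) d
      ... | no x≢ = subst (Dist T root x) (sym (updateAt-minimal x (suc i) depth x≢))
                      (isDepth x λ { (here x≡) → x≢ x≡ ; (there x∈) → x∉ x∈ })

    levelAlgorithm-reaches : Reaches T (const ⊤) levelAlgorithm (n + (suc n * suc n) / 4)
    levelAlgorithm-reaches = subst (λ l → Reaches T (const ⊤) levelAlgorithm (l + (suc n * suc n) / 4))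
      (length-tabulate {n = n} id) (exploreDepths-reaches (allFin n) (const 0) _ initial)
      where
      initial : ∀ x → x ∉ map suc (allFin n) → Dist T root x 0
      initial zero _ = stay , λ _ ()
      initial (suc i) i∉ = ⊥-elim (i∉ (∈-map⁺ suc (∈-allFin i)))

upper-bound : ∀ n → ∃[ k ] (Solvable (suc n) k × 4 * k ≤ suc n * suc n + 4 * suc n)
upper-bound n = n + B , (levelAlgorithm , levelAlgorithm-reaches) , (begin
  4 * (n + B)       ≡⟨ *-distribˡ-+ 4 n B ⟩
  4 * n + 4 * B     ≡⟨ +-comm (4 * n) (4 * B) ⟩
  4 * B + 4 * n     ≤⟨ +-mono-≤ (≤-trans (≤-reflexive (*-comm 4 B)) (m/n*n≤m (suc n * suc n) 4))
                                (*-monoʳ-≤ 4 (n≤1+n n)) ⟩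
  suc n * suc n + 4 * suc n ∎)
  where
  open Levels n
  open Run using (levelAlgorithm-reaches)
  open ≤-Reasoning
  B : ℕ
  B = (suc n * suc n) / 4

-- Colourings determined by constraints

¬¬-finite-choice : ∀ k {B : Fin k → Set} → (∀ i → DoubleNegation (B i)) → DoubleNegation (∀ i → B i)
¬¬-finite-choice zero _ = pure λ ()
¬¬-finite-choice (suc k) ¬¬B = ¬¬B zero >>= λ b₀ → ¬¬-finite-choice k (¬¬B ∘ suc) >>= λ bs →
  pure λ { zero → b₀ ; (suc i) → bs i }

Minimal : (ℕ → Set) → ℕ → Set
Minimal P t = P t × (∀ s → s < t → ¬ P s)

¬¬-minimal : (P : ℕ → Set) → ∀ t → P t → DoubleNegation (∃ (Minimal P))
¬¬-minimal P = <-rec (λ t → P t → DoubleNegation (∃ (Minimal P))) λ t smaller Pt →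
  ¬¬-excluded-middle {A = ∃[ s ] (s < t × P s)} >>= λ
    { (yes (s , s<t , Ps)) → smaller s<t Ps
    ; (no none-smaller) → pure (t , Pt , λ s s<t Ps → none-smaller (s , s<t , Ps)) }

injective₂⇒*≤ : ∀ {k l o} (h : Fin k → Fin l → Fin o) →
                (∀ {i j i′ j′} → h i j ≡ h i′ j′ → i ≡ i′ × j ≡ j′) → k * l ≤ o
injective₂⇒*≤ {k} {l} h h-injective = injective⇒≤ {f = uncurry h ∘ remQuot l} λ {x} {y} eq →
  trans (sym (combine-remQuot {k} l x))
    (trans (cong (uncurry combine) (×-≡,≡→≡ (h-injective eq))) (combine-remQuot {k} l y))

Colouring : ℕ → ℕ → Set
Colouring a m = Fin m → Fin (suc a)

Respects : ∀ {a m} → List (Fin (suc a) × Fin m) → List (Fin m × Fin m) → Colouring a m → Set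
Respects forbidden apart f =
  (∀ {i j} → (i , j) ∈ forbidden → f j ≢ i) × (∀ {j j′} → (j , j′) ∈ apart → f j ≢ f j′)

module KempeChains {a m : ℕ} (forbidden : List (Fin (suc a) × Fin m)) (apart : List (Fin m × Fin m))
  (c : Colouring a m) (c-respects : Respects forbidden apart c)
  (c-unique : ∀ f → Respects forbidden apart f → ∀ j → f j ≡ c j) where

  open import Data.List.Membership.DecPropositional (≡-dec (_≟ᶠ_ {suc a}) (_≟ᶠ_ {m})) using (_∈?_)

  Colour : Set
  Colour = Fin (suc a)

  Apart : Fin m → Fin m → Set
  Apart x y = (x , y) ∈ apart ⊎ (y , x) ∈ apart

  module KempeChain (α β : Colour) where

    Coloured : Fin m → Set
    Coloured x = c x ≡ α ⊎ c x ≡ β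

    swapped : Fin m → Colour
    swapped x with c x ≟ᶠ α
    ... | yes _ = β
    ... | no _ = α

    swapped-α : ∀ {x} → c x ≡ α → swapped x ≡ β
    swapped-α {x} cx≡α with c x ≟ᶠ α
    ... | yes _ = refl
    ... | no cx≢α = ⊥-elim (cx≢α cx≡α)

    swapped-¬α : ∀ {x} → c x ≢ α → swapped x ≡ α
    swapped-¬α {x} cx≢α with c x ≟ᶠ α
    ... | yes cx≡α = ⊥-elim (cx≢α cx≡α)
    ... | no _ = refl

    swapped-coloured : ∀ x → swapped x ≡ α ⊎ swapped x ≡ β
    swapped-coloured x with c x ≟ᶠ α
    ... | yes _ = inj₂ refl
    ... | no _ = inj₁ refl

    Recolourable : Fin m → Set
    Recolourable x = (swapped x , x) ∉ forbidden

    -- A Kempe chain from x ending at a vertex that cannot take its swapped colour.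
    data Escape : Fin m → ℕ → Set where
      blocked : ∀ {x} → Coloured x → ¬ Recolourable x → Escape x 0
      onward : ∀ {x y t} → Coloured x → Recolourable x → Apart x y → c y ≡ swapped x → Escape y t → Escape x (suc t)

  module _ {α β : Colour} (α≢β : α ≢ β) where
    private
      module αβ = KempeChain α β
      module βα = KempeChain β α

    swapped-sym : ∀ {x} → αβ.Coloured x → αβ.swapped x ≡ βα.swapped x
    swapped-sym (inj₁ cx≡α) = trans (αβ.swapped-α cx≡α) (sym (βα.swapped-¬α (α≢β ∘ trans (sym cx≡α))))
    swapped-sym (inj₂ cx≡β) =
      trans (αβ.swapped-¬α λ cx≡α → α≢β (trans (sym cx≡α) cx≡β)) (sym (βα.swapped-α cx≡β))

    escape-sym : ∀ {x t} → αβ.Escape x t → βα.Escape x t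
    escape-sym {x} (αβ.blocked col stuck) =
      βα.blocked ([ inj₂ , inj₁ ]′ col) (λ free → stuck (free ∘ subst (λ z → (z , x) ∈ forbidden) (swapped-sym col)))
    escape-sym {x} (αβ.onward col free e cy esc) =
      βα.onward ([ inj₂ , inj₁ ]′ col) (free ∘ subst (λ z → (z , x) ∈ forbidden) (sym (swapped-sym col))) e
        (trans cy (swapped-sym col)) (escape-sym esc)

  module Recolour (v : Fin m) (β : Colour) (β≢cv : β ≢ c v) where
    open KempeChain (c v) β

    coloured-by-swap : ∀ x y → c y ≡ swapped x → Coloured y
    coloured-by-swap x y cy with swapped-coloured x
    ... | inj₁ sx≡α = inj₁ (trans cy sx≡α)
    ... | inj₂ sx≡β = inj₂ (trans cy sx≡β)

    swapped-injective : ∀ {x y} → Coloured x → Coloured y → swapped x ≡ swapped y → c x ≡ c y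
    swapped-injective (inj₁ cx≡α) (inj₁ cy≡α) _ = trans cx≡α (sym cy≡α)
    swapped-injective (inj₂ cx≡β) (inj₂ cy≡β) _ = trans cx≡β (sym cy≡β)
    swapped-injective (inj₁ cx≡α) (inj₂ cy≡β) sx≡sy =
      ⊥-elim (β≢cv (trans (sym (swapped-α cx≡α)) (trans sx≡sy (swapped-¬α (β≢cv ∘ trans (sym cy≡β))))))
    swapped-injective (inj₂ cx≡β) (inj₁ cy≡α) sx≡sy =
      ⊥-elim (β≢cv (trans (sym (swapped-α cy≡α)) (trans (sym sx≡sy) (swapped-¬α (β≢cv ∘ trans (sym cx≡β))))))

    module _ (v-recolourable : Recolourable v) where

      data Reachable : Fin m → Set where
        start : Reachable v
        next : ∀ {x y} → Reachable x → Apart x y → c y ≡ swapped x → Recolourable y → Reachable y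

      reachable-recolourable : ∀ {x} → Reachable x → Coloured x × Recolourable x
      reachable-recolourable start = inj₁ refl , v-recolourable
      reachable-recolourable (next {x} {y} _ _ cy free) = coloured-by-swap x y cy , free

      reachable-escape : ∀ {x t} → Reachable x → Escape x t → ∃[ s ] Escape v s
      reachable-escape start esc = _ , esc
      reachable-escape (next r e cy _) esc = reachable-escape r
        (onward (proj₁ (reachable-recolourable r)) (proj₂ (reachable-recolourable r)) e cy esc)

      -- Otherwise swapping the two colours on the vertices reachable from v gives a second admissible colouring.
      escape-exists : DoubleNegation (∃[ t ] Escape v t)
      escape-exists no-escape = ¬¬-finite-choice m (λ x → ¬¬-excluded-middle {A = Reachable x}) second-colouring
        where
        module _ (reachable? : ∀ x → Dec (Reachable x)) where

          recoloured : Colouring a m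
          recoloured x with reachable? x
          ... | yes _ = swapped x
          ... | no _ = c x

          frontier : ∀ {x y} → Reachable x → Apart x y → ¬ Reachable y → swapped x ≢ c y
          frontier {x} {y} r e unreached sx≡cy with (swapped y , y) ∈? forbidden
          ... | no free = unreached (next r e (sym sx≡cy) free)
          ... | yes stuck = no-escape (reachable-escape r
                  (onward (proj₁ (reachable-recolourable r)) (proj₂ (reachable-recolourable r)) e (sym sx≡cy)
                    (blocked (coloured-by-swap x y (sym sx≡cy)) (λ free → free stuck))))

          forbidden-ok : ∀ {i x} → (i , x) ∈ forbidden → recoloured x ≢ i
          forbidden-ok {i} {x} i,x∈ with reachable? x
          ... | yes r = λ sx≡i → proj₂ (reachable-recolourable r) (subst (λ z → (z , x) ∈ forbidden) (sym sx≡i) i,x∈)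
          ... | no _ = proj₁ c-respects i,x∈

          apart-ok : ∀ {x y} → (x , y) ∈ apart → recoloured x ≢ recoloured y
          apart-ok {x} {y} x,y∈ with reachable? x | reachable? y
          ... | yes r | yes r′ = proj₂ c-respects x,y∈ ∘
                  swapped-injective (proj₁ (reachable-recolourable r)) (proj₁ (reachable-recolourable r′))
          ... | yes r | no u = frontier r (inj₁ x,y∈) u
          ... | no u | yes r = frontier r (inj₂ x,y∈) u ∘ sym
          ... | no _ | no _ = proj₂ c-respects x,y∈

          v-moved : recoloured v ≢ c v
          v-moved with reachable? v
          ... | yes _ = β≢cv ∘ trans (sym (swapped-α refl))
          ... | no unreached = ⊥-elim (unreached start)

          second-colouring : ⊥
          second-colouring = v-moved (c-unique recoloured (forbidden-ok , apart-ok) v)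

  -- (v, β) is witnessed either by a forbidding constraint or by the first edge of a shortest escape of v.
  Certificate : Fin m → Colour → Fin (length forbidden) ⊎ Fin (length apart) → Set
  Certificate v β (inj₁ i) = lookup forbidden i ≡ (β , v)
  Certificate v β (inj₂ i) = ∃[ y ] ∃[ t ] ((lookup apart i ≡ (v , y) ⊎ lookup apart i ≡ (y , v)) × c y ≡ β × β ≢ c v ×
    KempeChain.Escape (c v) β y t × (∀ s → s < suc t → ¬ KempeChain.Escape (c v) β v s))

  certificate : ∀ v β → β ≢ c v → DoubleNegation (∃ (Certificate v β))
  certificate v β β≢cv with (β , v) ∈? forbidden
  ... | yes β,v∈ = pure (inj₁ (index β,v∈) , sym (lookup-index β,v∈))
  ... | no β,v∉ = Recolour.escape-exists v β β≢cv v-free >>= λ (t , esc) → ¬¬-minimal (Escape v) t esc >>= first-step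
    where
    open KempeChain (c v) β
    v-free : Recolourable v
    v-free = β,v∉ ∘ subst (λ z → (z , v) ∈ forbidden) (swapped-α refl)
    first-step : ∃ (Minimal (Escape v)) → DoubleNegation (∃ (Certificate v β))
    first-step (_ , blocked _ stuck , _) = ⊥-elim (stuck v-free)
    first-step (_ , onward {y = y} {t = t} _ _ (inj₁ v,y∈) cy esc , minimal) =
      pure (inj₂ (index v,y∈) , y , t , inj₁ (sym (lookup-index v,y∈)) , trans cy (swapped-α refl) , β≢cv , esc , minimal)
    first-step (_ , onward {y = y} {t = t} _ _ (inj₂ y,v∈) cy esc , minimal) =
      pure (inj₂ (index y,v∈) , y , t , inj₂ (sym (lookup-index y,v∈)) , trans cy (swapped-α refl) , β≢cv , esc , minimal)

  -- The shorter of the two escapes would contradict the minimality of the other.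
  crossing : ∀ {v y t t′} → c v ≢ c y →
    KempeChain.Escape (c v) (c y) y t → (∀ s → s < suc t → ¬ KempeChain.Escape (c v) (c y) v s) →
    KempeChain.Escape (c y) (c v) v t′ → (∀ s → s < suc t′ → ¬ KempeChain.Escape (c y) (c v) y s) → ⊥
  crossing {t = t} {t′} cv≢cy esc minimal esc′ minimal′ with ≤-<-connex t′ t
  ... | inj₁ t′≤t = minimal t′ (s≤s t′≤t) (escape-sym (cv≢cy ∘ sym) esc′)
  ... | inj₂ t<t′ = minimal′ t (≤-trans t<t′ (n≤1+n t′)) (escape-sym cv≢cy esc)

  certificate-injective : ∀ {v β v′ β′} k → Certificate v β k → Certificate v′ β′ k → v ≡ v′ × β ≡ β′
  certificate-injective (inj₁ i) eq eq′ with ,-injective (trans (sym eq) eq′)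
  ... | refl , refl = refl , refl
  certificate-injective (inj₂ i) (_ , _ , inj₁ e , refl , _) (_ , _ , inj₁ e′ , refl , _) with ,-injective (trans (sym e) e′)
  ... | refl , refl = refl , refl
  certificate-injective (inj₂ i) (_ , _ , inj₂ e , refl , _) (_ , _ , inj₂ e′ , refl , _) with ,-injective (trans (sym e) e′)
  ... | refl , refl = refl , refl
  certificate-injective (inj₂ i) (_ , _ , inj₁ e , refl , β≢ , esc , min) (_ , _ , inj₂ e′ , refl , _ , esc′ , min′)
    with ,-injective (trans (sym e) e′)
  ... | refl , refl = ⊥-elim (crossing (β≢ ∘ sym) esc min esc′ min′)
  certificate-injective (inj₂ i) (_ , _ , inj₂ e , refl , _ , esc , min) (_ , _ , inj₁ e′ , refl , β≢′ , esc′ , min′)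
    with ,-injective (trans (sym e) e′)
  ... | refl , refl = ⊥-elim (crossing (β≢′ ∘ sym) esc′ min′ esc min)

  constraint-count : m * a ≤ length forbidden + length apart
  constraint-count = decidable-stable (_ ≤? _) (¬¬-finite-choice m (λ v → ¬¬-finite-choice a λ j →
    certificate v (punchIn (c v) j) (punchInᵢ≢i (c v) j)) >>= λ certificates →
    pure (injective₂⇒*≤ (λ v j → join _ _ (proj₁ (certificates v j))) (distinct-certificates certificates)))
    where
    distinct-certificates : (certificates : ∀ v j → ∃ (Certificate v (punchIn (c v) j))) →
      ∀ {v j v′ j′} → join _ _ (proj₁ (certificates v j)) ≡ join _ _ (proj₁ (certificates v′ j′)) →
      v ≡ v′ × j ≡ j′
    distinct-certificates certificates {v} {j} {v′} {j′} eq
      with certificate-injective _ (proj₂ (certificates v j))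
             (subst (Certificate v′ _) (sym same-code) (proj₂ (certificates v′ j′)))
      where
      same-code : proj₁ (certificates v j) ≡ proj₁ (certificates v′ j′)
      same-code = trans (sym (splitAt-join _ _ _)) (trans (cong (splitAt _) eq) (splitAt-join _ _ _))
    ... | refl , same-colour = refl , punchIn-injective (c v) j j′ same-colour

-- The hard family and the adversary

does-true : ∀ {P : Set} (d : Dec P) → does d ≡ true → P
does-true (yes p) _ = p

module HardFamily (a m : ℕ) where

  n : ℕ
  n = suc (a + m)

  data Vertex : Set where
    root : Vertex
    A : Fin a → Vertex
    B : Fin m → Vertex

  kind : Fin n → Vertex
  kind zero = root
  kind (suc i) = [ A , B ]′ (splitAt a i)

  embed : Vertex → Fin n
  embed root = zero
  embed (A p) = suc (p ↑ˡ m)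
  embed (B q) = suc (a ↑ʳ q)

  kind-embed : ∀ u → kind (embed u) ≡ u
  kind-embed root = refl
  kind-embed (A p) = cong [ A , B ]′ (splitAt-↑ˡ a p m)
  kind-embed (B q) = cong [ A , B ]′ (splitAt-↑ʳ a m q)

  embed-kind : ∀ x → embed (kind x) ≡ x
  embed-kind zero = refl
  embed-kind (suc i) = trans (embed-side (splitAt a i)) (cong suc (join-splitAt a m i))
    where
    embed-side : ∀ s → embed ([ A , B ]′ s) ≡ suc (join a m s)
    embed-side (inj₁ _) = refl
    embed-side (inj₂ _) = refl

  embed-injective : ∀ {u v} → embed u ≡ embed v → u ≡ v
  embed-injective {u} {v} eq = trans (sym (kind-embed u)) (trans (cong kind eq) (kind-embed v))

  level : Vertex → ℕ
  level root = 0
  level (A _) = 1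
  level (B _) = 2

  -- B q hangs from A (f q); f is the unknown the adversary keeps open.
  module _ (f : Fin m → Fin a) where

    adjacent : Vertex → Vertex → Bool
    adjacent root (A _) = true
    adjacent (A _) root = true
    adjacent (A p) (B q) = does (f q ≟ᶠ p)
    adjacent (B q) (A p) = does (f q ≟ᶠ p)
    adjacent _ _ = false

    tree : Graph n
    tree x y = adjacent (kind x) (kind y)

    parentOf : Vertex → Vertex
    parentOf root = root
    parentOf (A _) = root
    parentOf (B q) = A (f q)

    adjacent-sym : ∀ u v → adjacent u v ≡ adjacent v u
    adjacent-sym root root = refl
    adjacent-sym root (A _) = refl
    adjacent-sym root (B _) = refl
    adjacent-sym (A _) root = refl
    adjacent-sym (A _) (A _) = refl
    adjacent-sym (A _) (B _) = refl
    adjacent-sym (B _) root = refl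
    adjacent-sym (B _) (A _) = refl
    adjacent-sym (B _) (B _) = refl

    not-adjacent-self : ∀ u → ¬ adjacent u u ≡ true
    not-adjacent-self root ()
    not-adjacent-self (A _) ()
    not-adjacent-self (B _) ()

    adjacent-cases : ∀ u v → adjacent u v ≡ true →
      (v ≡ parentOf u × OneDeeper level u v) ⊎ (u ≡ parentOf v × OneDeeper level v u)
    adjacent-cases root (A _) _ = inj₂ (refl , refl)
    adjacent-cases (A _) root _ = inj₁ (refl , refl)
    adjacent-cases (A p) (B q) e = inj₂ (cong A (sym (does-true (f q ≟ᶠ p) e)) , refl)
    adjacent-cases (B q) (A p) e = inj₁ (cong A (sym (does-true (f q ≟ᶠ p) e)) , refl)
    adjacent-cases root root ()
    adjacent-cases root (B _) ()
    adjacent-cases (A _) (A _) ()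
    adjacent-cases (B _) root ()
    adjacent-cases (B _) (B _) ()

    edge : ∀ u v → adjacent u v ≡ true → Adj tree (embed u) (embed v)
    edge u v = subst₂ (λ u′ v′ → adjacent u′ v′ ≡ true) (sym (kind-embed u)) (sym (kind-embed v))

    tree-sym : ∀ x y → tree x y ≡ tree y x
    tree-sym x y = adjacent-sym (kind x) (kind y)

    hangs : ∀ q → adjacent (B q) (A (f q)) ≡ true
    hangs q = dec-true (f q ≟ᶠ f q) refl

    to-root : ∀ u → Walk tree (embed u) (embed root) (level u)
    to-root root = stay
    to-root (A p) = step (edge (A p) root refl) stay
    to-root (B q) = step (edge (B q) (A (f q)) (hangs q)) (to-root (A (f q)))

    via-root : ∀ u v → Walk tree (embed u) (embed v) (level u + level v)
    via-root u v = walk-++ (to-root u) (walk-reverse tree-sym (to-root v))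

    isTree : IsTree tree
    isTree = tree-sym , not-adjacent-self ∘ kind , connected , parent-edges⇒acyclic parent height {G = tree} parent-edge
      where
      connected : Connected tree
      connected x y = _ , subst₂ (λ x′ y′ → Walk tree x′ y′ (level (kind x) + level (kind y))) (embed-kind x) (embed-kind y)
        (via-root (kind x) (kind y))
      parent : Fin n → Fin n
      parent = embed ∘ parentOf ∘ kind
      height : Fin n → ℕ
      height = level ∘ kind
      parent-edge : ∀ {x y} → Adj tree x y → ToParent parent height x y ⊎ ToChild parent height x y
      parent-edge {x} {y} e with adjacent-cases (kind x) (kind y) e
      ... | inj₁ (y-parent , deeper) = inj₁ (trans (sym (embed-kind y)) (cong embed y-parent) , ≤-reflexive deeper)
      ... | inj₂ (x-parent , deeper) = inj₂ (trans (sym (embed-kind x)) (cong embed x-parent) , ≤-reflexive deeper)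

    Path : Vertex → Vertex → ℕ → Set
    Path u v = Walk tree (embed u) (embed v)

    path₀⇒≡ : ∀ {u v} → Path u v 0 → u ≡ v
    path₀⇒≡ = embed-injective ∘ walk₀⇒≡

    path₁⇒adjacent : ∀ {u v} → Path u v 1 → adjacent u v ≡ true
    path₁⇒adjacent {u} {v} = subst₂ (λ u′ v′ → adjacent u′ v′ ≡ true) (kind-embed u) (kind-embed v) ∘ walk₁⇒adj

    path₂⇒common-neighbour : ∀ {u v} → Path u v 2 → ∃[ w ] (adjacent u w ≡ true × adjacent w v ≡ true)
    path₂⇒common-neighbour {u} {v} p with walk₂⇒common-neighbour p
    ... | x , e₁ , e₂ = kind x , subst (λ u′ → adjacent u′ (kind x) ≡ true) (kind-embed u) e₁ ,
                                  subst (λ v′ → adjacent (kind x) v′ ≡ true) (kind-embed v) e₂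

    path-parity : ∀ {u v s} → Path u v s → parity s ≡ parity (level u) ℙ.+ parity (level v)
    path-parity {u} {v} {s} p =
      subst₂ (λ u′ v′ → parity s ≡ parity (level u′) ℙ.+ parity (level v′)) (kind-embed u) (kind-embed v)
      (walk-parity (parity ∘ level ∘ kind) proper p)
      where
      proper : ∀ x y → Adj tree x y → parity (level (kind x)) ≡ parity (level (kind y)) ⁻¹
      proper x y e with adjacent-cases (kind x) (kind y) e
      ... | inj₁ (_ , deeper) = oneDeeper⇒opposite-parity level deeper
      ... | inj₂ (_ , deeper) = sym (⁻¹-selfInverse (sym (oneDeeper⇒opposite-parity level deeper)))

    1ℙ≢0ℙ : 1ℙ ≢ 0ℙ
    1ℙ≢0ℙ ()

    dist₂ : ∀ {u v} → u ≢ v → parity (level u) ℙ.+ parity (level v) ≡ 0ℙ → Path u v 2 → Dist tree (embed u) (embed v) 2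
    dist₂ u≢v even p = p , λ
      { zero _ p₀ → u≢v (path₀⇒≡ p₀)
      ; (suc zero) _ p₁ → 1ℙ≢0ℙ (trans (path-parity p₁) even)
      ; (suc (suc _)) (s≤s (s≤s ())) _ }

    dist₃ : ∀ {u v} → u ≢ v → ¬ adjacent u v ≡ true → parity (level u) ℙ.+ parity (level v) ≡ 1ℙ → Path u v 3 →
            Dist tree (embed u) (embed v) 3
    dist₃ u≢v apart odd p = p , λ
      { zero _ p₀ → u≢v (path₀⇒≡ p₀)
      ; (suc zero) _ p₁ → apart (path₁⇒adjacent p₁)
      ; (suc (suc zero)) _ p₂ → 1ℙ≢0ℙ (sym (trans (path-parity p₂) odd))
      ; (suc (suc (suc _))) (s≤s (s≤s (s≤s ()))) _ }

    dist₄ : ∀ {u v} → u ≢ v → parity (level u) ℙ.+ parity (level v) ≡ 0ℙ →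
            (∀ w → adjacent u w ≡ true → adjacent w v ≡ true → ⊥) → Path u v 4 → Dist tree (embed u) (embed v) 4
    dist₄ u≢v even no-common p = p , λ
      { zero _ p₀ → u≢v (path₀⇒≡ p₀)
      ; (suc zero) _ p₁ → 1ℙ≢0ℙ (trans (path-parity p₁) even)
      ; (suc (suc zero)) _ p₂ → let (w , e₁ , e₂) = path₂⇒common-neighbour p₂ in no-common w e₁ e₂
      ; (suc (suc (suc zero))) _ p₃ → 1ℙ≢0ℙ (trans (path-parity p₃) even)
      ; (suc (suc (suc (suc _)))) (s≤s (s≤s (s≤s (s≤s ())))) _ }

    distance : Vertex → Vertex → ℕ
    distance (A p) (B q) = if does (f q ≟ᶠ p) then 1 else 3
    distance (B q) (A p) = if does (f q ≟ᶠ p) then 1 else 3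
    distance (B q) (B q′) = if does (f q ≟ᶠ f q′) then 2 else 4
    distance u v = level u + level v

    distance-correct : ∀ u v → u ≢ v → Dist tree (embed u) (embed v) (distance u v)
    distance-correct root root u≢v = ⊥-elim (u≢v refl)
    distance-correct root (A p) u≢v = adj⇒dist₁ (u≢v ∘ embed-injective) (edge root (A p) refl)
    distance-correct root (B q) u≢v = dist₂ u≢v refl (via-root root (B q))
    distance-correct (A p) root u≢v = adj⇒dist₁ (u≢v ∘ embed-injective) (edge (A p) root refl)
    distance-correct (A p) (A p′) u≢v = dist₂ u≢v refl (via-root (A p) (A p′))
    distance-correct (A p) (B q) u≢v with f q ≟ᶠ p
    ... | yes fq≡p = adj⇒dist₁ (u≢v ∘ embed-injective) (edge (A p) (B q) (dec-true (f q ≟ᶠ p) fq≡p))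
    ... | no fq≢p = dist₃ u≢v (fq≢p ∘ does-true (f q ≟ᶠ p)) refl (via-root (A p) (B q))
    distance-correct (B q) root u≢v = dist₂ u≢v refl (via-root (B q) root)
    distance-correct (B q) (A p) u≢v with f q ≟ᶠ p
    ... | yes fq≡p = adj⇒dist₁ (u≢v ∘ embed-injective) (edge (B q) (A p) (dec-true (f q ≟ᶠ p) fq≡p))
    ... | no fq≢p = dist₃ u≢v (fq≢p ∘ does-true (f q ≟ᶠ p)) refl (via-root (B q) (A p))
    distance-correct (B q) (B q′) u≢v with f q ≟ᶠ f q′
    ... | yes siblings = dist₂ u≢v refl
            (step (edge (B q) (A (f q)) (hangs q)) (step (edge (A (f q)) (B q′) (dec-true (f q′ ≟ᶠ f q) (sym siblings))) stay))
    ... | no cousins = dist₄ u≢v refl no-common-neighbour (via-root (B q) (B q′))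
      where
      no-common-neighbour : ∀ w → adjacent (B q) w ≡ true → adjacent w (B q′) ≡ true → ⊥
      no-common-neighbour (A p) e₁ e₂ = cousins (trans (does-true (f q ≟ᶠ p) e₁) (sym (does-true (f q′ ≟ᶠ p) e₂)))

  kind-injective : ∀ {x y} → kind x ≡ kind y → x ≡ y
  kind-injective {x} {y} eq = trans (sym (embed-kind x)) (trans (cong embed eq) (embed-kind y))

  tree-dist : ∀ f {x y} → x ≢ y → Dist (tree f) x y (distance f (kind x) (kind y))
  tree-dist f {x} {y} x≢y =
    subst₂ (λ x′ y′ → Dist (tree f) x′ y′ (distance f (kind x) (kind y))) (embed-kind x) (embed-kind y)
    (distance-correct f (kind x) (kind y) (x≢y ∘ kind-injective))

  tree-injective : ∀ f g → SameGraph (tree f) (tree g) → ∀ j → f j ≡ g j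
  tree-injective f g same j = sym (does-true (g j ≟ᶠ f j) (begin
    adjacent g (A (f j)) (B j)            ≡⟨ sym (tree-adjacent g (A (f j)) (B j)) ⟩
    tree g (embed (A (f j))) (embed (B j)) ≡⟨ sym (same (embed (A (f j))) (embed (B j))) ⟩
    tree f (embed (A (f j))) (embed (B j)) ≡⟨ tree-adjacent f (A (f j)) (B j) ⟩
    adjacent f (A (f j)) (B j)            ≡⟨ dec-true (f j ≟ᶠ f j) refl ⟩
    true                                  ∎))
    where
    open ≡-Reasoning
    tree-adjacent : ∀ h u v → tree h (embed u) (embed v) ≡ adjacent h u v
    tree-adjacent h u v = cong₂ (adjacent h) (kind-embed u) (kind-embed v)

module Adversary (a m : ℕ) where
  open HardFamily (suc a) m

  -- Constraints on f to which the answers given so far have committed the adversary.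
  Forbidden Apart : Set
  Forbidden = List (Fin (suc a) × Fin m)
  Apart = List (Fin m × Fin m)

  record Reply (forbidden : Forbidden) (apart : Apart) (u v : Vertex) : Set where
    field
      forbidden′ : Forbidden
      apart′ : Apart
      answer : ℕ
      refines : ∀ f → Respects forbidden′ apart′ f → Respects forbidden apart f
      answers : ∀ f → Respects forbidden′ apart′ f → distance f u v ≡ answer
      satisfiable : ∃ (Respects forbidden′ apart′)
      one-more : length forbidden′ + length apart′ ≤ suc (length forbidden + length apart)

  module _ {forbidden : Forbidden} {apart : Apart} where

    entailed : ∀ {P : Colouring a m → Set} → (∀ f → Dec (P f)) →
               ¬ (∃[ f ] (Respects forbidden apart f × ¬ P f)) → ∀ f → Respects forbidden apart f → P f
    entailed P? no-counterexample f r with P? f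
    ... | yes Pf = Pf
    ... | no ¬Pf = ⊥-elim (no-counterexample (f , r , ¬Pf))

  module _ {forbidden : Forbidden} {apart : Apart} {u v : Vertex} (sat : ∃ (Respects forbidden apart)) where

    unchanged : ∀ d → (∀ f → Respects forbidden apart f → distance f u v ≡ d) → Reply forbidden apart u v
    unchanged d fixed = record
      { forbidden′ = forbidden ; apart′ = apart ; answer = d ; refines = λ _ r → r ; answers = fixed
      ; satisfiable = sat ; one-more = n≤1+n _ }

    reply-parent : ∀ p q → (∀ f → distance f u v ≡ (if does (f q ≟ᶠ p) then 1 else 3)) →
                   DoubleNegation (Reply forbidden apart u v)
    reply-parent p q dist = ¬¬-excluded-middle {A = ∃[ f ] (Respects forbidden apart f × f q ≢ p)} >>= λ
      { (yes (f , (fine , apart-ok) , fq≢p)) → pure record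
          { forbidden′ = (p , q) ∷ forbidden ; apart′ = apart ; answer = 3
          ; refines = λ _ (fine′ , apart-ok′) → fine′ ∘ there , apart-ok′
          ; answers = λ f (fine′ , _) →
              trans (dist f) (cong (λ b → if b then 1 else 3) (dec-false (f q ≟ᶠ p) (fine′ (here refl))))
          ; satisfiable = f , (λ { (here refl) → fq≢p ; (there i,j∈) → fine i,j∈ }) , apart-ok
          ; one-more = ≤-refl }
      ; (no never) → pure (unchanged 1 λ f r → trans (dist f) (cong (λ b → if b then 1 else 3)
          (dec-true (f q ≟ᶠ p) (entailed (λ f → f q ≟ᶠ p) never f r)))) }

    reply-siblings : ∀ q q′ → (∀ f → distance f u v ≡ (if does (f q ≟ᶠ f q′) then 2 else 4)) →
                     DoubleNegation (Reply forbidden apart u v)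
    reply-siblings q q′ dist = ¬¬-excluded-middle {A = ∃[ f ] (Respects forbidden apart f × f q ≢ f q′)} >>= λ
      { (yes (f , (fine , apart-ok) , fq≢fq′)) → pure record
          { forbidden′ = forbidden ; apart′ = (q , q′) ∷ apart ; answer = 4
          ; refines = λ _ (fine′ , apart-ok′) → fine′ , apart-ok′ ∘ there
          ; answers = λ f (_ , apart-ok′) →
              trans (dist f) (cong (λ b → if b then 2 else 4) (dec-false (f q ≟ᶠ f q′) (apart-ok′ (here refl))))
          ; satisfiable = f , fine , λ { (here refl) → fq≢fq′ ; (there j,j′∈) → apart-ok j,j′∈ }
          ; one-more = ≤-reflexive (+-suc (length forbidden) (length apart)) }
      ; (no never) → pure (unchanged 2 λ f r → trans (dist f) (cong (λ b → if b then 2 else 4)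
          (dec-true (f q ≟ᶠ f q′) (entailed (λ f → f q ≟ᶠ f q′) never f r)))) }

  -- The adversary gives the far answer whenever some colouring consistent so far allows it.
  reply : ∀ forbidden apart u v → ∃ (Respects forbidden apart) → DoubleNegation (Reply forbidden apart u v)
  reply _ _ (A p) (B q) sat = reply-parent sat p q λ _ → refl
  reply _ _ (B q) (A p) sat = reply-parent sat p q λ _ → refl
  reply _ _ (B q) (B q′) sat = reply-siblings sat q q′ λ _ → refl
  reply _ _ root root sat = pure (unchanged sat 0 λ _ _ → refl)
  reply _ _ root (A _) sat = pure (unchanged sat 1 λ _ _ → refl)
  reply _ _ root (B _) sat = pure (unchanged sat 2 λ _ _ → refl)
  reply _ _ (A _) root sat = pure (unchanged sat 1 λ _ _ → refl)
  reply _ _ (A _) (A _) sat = pure (unchanged sat 2 λ _ _ → refl)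
  reply _ _ (B _) root sat = pure (unchanged sat 2 λ _ _ → refl)

  determined⇒constraints : ∀ forbidden apart {C : Knowledge n} → (∀ f → Respects forbidden apart f → C (tree f)) →
    ∀ f₀ → Respects forbidden apart f₀ → Determined (tree f₀) C → m * a ≤ length forbidden + length apart
  determined⇒constraints forbidden apart consistent f₀ r₀ determined = KempeChains.constraint-count forbidden apart f₀ r₀
    λ f r → tree-injective f f₀ (determined (tree f) (isTree f) (consistent f r))

  learns : ∀ {forbidden apart x y} → x ≢ y → (rep : Reply forbidden apart (kind x) (kind y)) →
           let open Reply rep in ∀ f → Respects forbidden′ apart′ f → Dist (tree f) x y answer
  learns {x = x} {y} x≢y rep f r = subst (Dist (tree f) x y) (answers f r) (tree-dist f x≢y)
    where open Reply rep

  adversary : ∀ (alg : Alg n) k forbidden apart (C : Knowledge n) →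
    (∀ f → Respects forbidden apart f → C (tree f)) →
    (∀ f → Respects forbidden apart f → Reaches (tree f) C alg k) →
    ∃ (Respects forbidden apart) → DoubleNegation (m * a ≤ k + (length forbidden + length apart))
  adversary done k forbidden apart C consistent reaches (f₀ , r₀) =
    pure (≤-trans (determined⇒constraints forbidden apart consistent f₀ r₀ (reaches f₀ r₀)) (m≤n+m _ k))
  adversary (ask _ _ _ _) zero forbidden apart C consistent reaches (f₀ , r₀) =
    pure (determined⇒constraints forbidden apart consistent f₀ r₀ (reaches f₀ r₀))
  adversary (ask x y x≢y next) (suc k) forbidden apart C consistent reaches sat =
    ¬¬-excluded-middle {A = ∃[ f ] (Respects forbidden apart f × Determined (tree f) C)} >>= λ
      { (yes (f , r , determined)) →
          pure (≤-trans (determined⇒constraints forbidden apart consistent f r determined) (m≤n+m _ (suc k)))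
      ; (no undetermined) → reply forbidden apart (kind x) (kind y) sat >>= λ rep → let open Reply rep in
          adversary (next answer) k forbidden′ apart′ _ (λ f r → consistent f (refines f r) , learns x≢y rep f r)
            (λ f r → [ (λ determined → ⊥-elim (undetermined (f , refines f r , determined)))
                     , (λ proceed → proceed answer (learns x≢y rep f r)) ]′ (reaches f (refines f r)))
            satisfiable
          >>= λ bound → pure (≤-trans bound (≤-trans (+-monoʳ-≤ k one-more) (≤-reflexive (+-suc k _)))) }

lower-bound : ∀ a m k → Solvable (suc (suc a + m)) k → m * a ≤ k
lower-bound a m k (alg , solves) = subst (m * a ≤_) (+-identityʳ k) (decidable-stable (_ ≤? _)
  (adversary alg k [] [] (const ⊤) (λ _ _ → tt) (λ f _ → solves (tree f) (isTree f)) (const zero , (λ ()) , (λ ()))))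
  where
  open Adversary a m
  open HardFamily (suc a) m using (tree; isTree)

halves : ∀ s → ∃[ a ] (s ≡ a + a ⊎ s ≡ a + suc a)
halves zero = 0 , inj₁ refl
halves (suc s) with halves s
... | a , inj₁ refl = a , inj₂ (sym (+-suc a a))
... | a , inj₂ refl = suc a , inj₁ refl

balanced-split : ∀ s → ∃[ a ] ∃[ m ] (a + m ≡ s × s * s ≤ 4 * (m * a) + 1)
balanced-split s with halves s
... | a , inj₁ refl = a , a , refl , ≤-trans (≤-reflexive (even a)) (m≤m+n _ 1)
  where
  even : ∀ a → (a + a) * (a + a) ≡ 4 * (a * a)
  even = solve-∀
... | a , inj₂ refl = a , suc a , refl , ≤-reflexive (odd a)
  where
  odd : ∀ a → (a + suc a) * (a + suc a) ≡ 4 * (suc a * a) + 1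
  odd = solve-∀

square-bound : ∀ s p k → s * s ≤ 4 * p + 1 → p ≤ k → (2 + s) * (2 + s) ≤ 4 * k + 6 * (2 + s)
square-bound s p k s²≤ p≤k = begin
  (2 + s) * (2 + s)                      ≡⟨ expand s ⟩
  s * s + (4 * s + 4)                    ≤⟨ +-monoˡ-≤ (4 * s + 4) (≤-trans s²≤ (+-monoˡ-≤ 1 (*-monoʳ-≤ 4 p≤k))) ⟩
  4 * k + 1 + (4 * s + 4)                ≤⟨ m≤m+n _ (2 * s + 7) ⟩
  4 * k + 1 + (4 * s + 4) + (2 * s + 7)  ≡⟨ regroup k s ⟩
  4 * k + 6 * (2 + s)                    ∎
  where
  open ≤-Reasoning
  expand : ∀ s → (2 + s) * (2 + s) ≡ s * s + (4 * s + 4)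
  expand = solve-∀
  regroup : ∀ k s → 4 * k + 1 + (4 * s + 4) + (2 * s + 7) ≡ 4 * k + 6 * (2 + s)
  regroup = solve-∀

proposition1p3 : ∃[ C ] ∃[ N ] ∀ n → N ≤ n →
    (∃[ k ] (Solvable n k × 4 * k ≤ n * n + C * n))
    × (∀ k → Solvable n k → n * n ≤ 4 * k + C * n)
proposition1p3 = 6 , 2 , bounds
  where
  bounds : ∀ n → 2 ≤ n →
    (∃[ k ] (Solvable n k × 4 * k ≤ n * n + 6 * n)) × (∀ k → Solvable n k → n * n ≤ 4 * k + 6 * n)
  bounds (suc (suc s)) _ = achievable , unavoidable
    where
    achievable : ∃[ k ] (Solvable (2 + s) k × 4 * k ≤ (2 + s) * (2 + s) + 6 * (2 + s))
    achievable with upper-bound (suc s)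
    ... | k , solvable , 4k≤ = k , solvable , ≤-trans 4k≤ (+-monoʳ-≤ ((2 + s) * (2 + s)) (*-monoˡ-≤ (2 + s) (m≤m+n 4 2)))
    unavoidable : ∀ k → Solvable (2 + s) k → (2 + s) * (2 + s) ≤ 4 * k + 6 * (2 + s)
    unavoidable k solvable with balanced-split s
    ... | a , m , refl , s²≤ = square-bound (a + m) (m * a) k s²≤ (lower-bound a m k solvable)
  bounds (suc zero) (s≤s ())
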